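{- Let $a_4,a_6\in\mathbb Z$ with $\Delta:=-16(4a_4^3+27a_6^2)\ne0$, and put $\alpha_4=v_2(a_4)$, $\alpha_6=v_2(a_6)$, $d=v_2(\Delta)$. The model $y^2=x^3+a_4x+a_6$ is not $2$-minimal if and only if one of the following holds: (1) $\alpha_4\ge4$ and $\alpha_6\ge6$; (2) $\alpha_4\ge4$ and $a_6\equiv16\pmod{64}$; (3) $(a_4,a_6)\equiv(5,6)\pmod 8$ and $d\ge12$.
   Context: $v_2$ is the $2$-adic valuation with $v_2(0)=+\infty$. A model is $2$-minimal if $v_2$ of its discriminant is minimal among all $2$-integral (general, long) Weierstrass models of the same elliptic curve. -}

module Defs where

open import Data.Nat as ℕ using (ℕ; zero; suc)
open import Data.Nat.DivMod as NDM using ()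
open import Data.Integer as ℤ using (ℤ; +_)
open import Data.Integer.Divisibility using (_∣_)
open import Data.Rational as ℚ using (ℚ; ↥_; ↧ₙ_; _+_; _*_; _-_; -_; 0ℚ)
open import Data.Product using (Σ; _×_; ∃)
open import Relation.Binary.PropositionalEquality using (_≡_; _≢_)
open import Relation.Nullary using (¬_)

-- v₂ on natural numbers, by fuel-bounded recursion (fuel n suffices).
-- Convention v2ℕ 0 = 0; it is only ever applied to nonzero numbers.
v2-go : ℕ → ℕ → ℕ
v2-go zero    n       = 0
v2-go (suc f) zero    = 0
v2-go (suc f) (suc m) with suc m NDM.% 2
... | zero  = suc (v2-go f (suc m NDM./ 2))
... | suc _ = 0

v2ℕ : ℕ → ℕ
v2ℕ n = v2-go n n

v2ℚ : ℚ → ℤ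
v2ℚ q = + v2ℕ ℤ.∣ ↥ q ∣ ℤ.- + v2ℕ (↧ₙ q)

-- "v₂(n) ≥ k" for an integer n (true for n = 0 since v₂(0) = +∞).
v2≥ : ℤ → ℕ → Set
v2≥ n k = (+ (2 ℕ.^ k)) ∣ n

Integral2 : ℚ → Set
Integral2 q = ↧ₙ q NDM.% 2 ≡ 1

-- Weierstrass models over ℚ  y² + a1 xy + a3 y = x³ + a2 x² + a4 x + a6

record Model : Set where
  constructor model
  field
    a1 a2 a3 a4 a6 : ℚ
open Model public

ℚof : ℤ → ℚ
ℚof n = n ℚ./ 1

k : ℤ → ℚ
k = ℚof

disc : Model → ℚ
disc E = (- (b2 * b2 * b8)) - k (+ 8) * b4 * b4 * b4 - k (+ 27) * b6 * b6
           + k (+ 9) * b2 * b4 * b6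
  where
  A1 = a1 E ; A2 = a2 E ; A3 = a3 E ; A4 = a4 E ; A6 = a6 E
  b2 = A1 * A1 + k (+ 4) * A2
  b4 = k (+ 2) * A4 + A1 * A3
  b6 = A3 * A3 + k (+ 4) * A6
  b8 = A1 * A1 * A6 + k (+ 4) * A2 * A6 - A1 * A3 * A4 + A2 * A3 * A3 - A4 * A4

IntegralModel2 : Model → Set
IntegralModel2 E = Integral2 (a1 E) × Integral2 (a2 E) × Integral2 (a3 E)
                 × Integral2 (a4 E) × Integral2 (a6 E)

-- E' is obtained from E by the change of variables
--   x = u² x' + r ,  y = u³ y' + s u² x' + t   (u ≠ 0; u,r,s,t ∈ ℚ)
-- (standard transformation formulas, Silverman III.1).
Transforms : Model → Model → Set
Transforms E E' = Σ ℚ λ u → Σ ℚ λ r → Σ ℚ λ s → Σ ℚ λ t →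
    (u ≢ 0ℚ)
  × (u * a1 E' ≡ a1 E + k (+ 2) * s)
  × (u * u * a2 E' ≡ a2 E - s * a1 E + k (+ 3) * r - s * s)
  × (u * u * u * a3 E' ≡ a3 E + r * a1 E + k (+ 2) * t)
  × (u * u * u * u * a4 E' ≡
       a4 E - s * a3 E + k (+ 2) * r * a2 E - (t + r * s) * a1 E
       + k (+ 3) * r * r - k (+ 2) * s * t)
  × (u * u * u * u * u * u * a6 E' ≡
       a6 E + r * a4 E + r * r * a2 E + r * r * r - t * a3 E - t * t
       - r * t * a1 E)

NotMinimal2 : Model → Set
NotMinimal2 E = ∃ λ E' → IntegralModel2 E' × Transforms E E'
                  × (v2ℚ (disc E') ℤ.< v2ℚ (disc E))

short : ℤ → ℤ → Model
short A4 A6 = model 0ℚ 0ℚ 0ℚ (ℚof A4) (ℚof A6)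

Δshort : ℤ → ℤ → ℤ
Δshort A4 A6 = ℤ.- (+ 16 ℤ.* (+ 4 ℤ.* A4 ℤ.* A4 ℤ.* A4 ℤ.+ + 27 ℤ.* A6 ℤ.* A6))

-- A change of variables (u, r, s, t) multiplies the discriminant by u⁻¹², so a 2-integral model
-- with smaller v₂(Δ) forces v₂(u) ≥ 1 and v₂(Δ) ≥ 12. Writing u = 2u₀, the transformation formulas
-- of a short model solve to 3r = 4X + s², t = 4τ, a₄ = 16Z − 3r² + 2st and a₆ = 64W − ra₄ − r³ + t²
-- with X, τ, Z, W 2-integral. If s is even then r = 4ρ, 16 ∣ a₄ and 64 ∣ a₆ or a₆ − 16 according
-- to the parity of τ; if s is odd then r = 3 + 4ρ, a₄ ≡ 5 and a₆ ≡ 6 (mod 8). Conversely each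
-- condition comes with an explicit change of variables with u = 2 to a 2-integral model; in
-- case (3) it is 2¹² ∣ Δ that makes the new a₆ integral.

{-# OPTIONS --safe #-}
module Submission where

open import Defs

open import Data.Integer as ℤ using (ℤ; +_; +≤+; +<+)
import Data.Integer.DivMod as ℤ
open import Data.Integer.Divisibility using (_∣_)
import Data.Integer.Divisibility.Signed as Signed
import Data.Integer.Properties as ℤₚ
import Data.Integer.Tactic.RingSolver as ℤ-Solver
open import Data.List using (_∷_; [])
open import Data.Maybe.Base using (Maybe; just; nothing)
open import Data.Nat as ℕ using (ℕ; zero; suc; z≤n; s≤s)
import Data.Nat.Coprimality as ℕ
import Data.Nat.DivMod as ℕ
import Data.Nat.Divisibility as ℕ
import Data.Nat.GCD as ℕ
import Data.Nat.Properties as ℕₚ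
import Data.Nat.Tactic.RingSolver as ℕ-Solver
open import Data.Product using (Σ-syntax; _×_; _,_; proj₁; proj₂)
open import Data.Rational as ℚ using (ℚ; mkℚ; ↥_; ↧_; ↧ₙ_; _+_; _*_; _-_; -_; 0ℚ; 1ℚ; ½; toℚᵘ)
import Data.Rational.Properties as ℚₚ
open import Data.Rational.Unnormalised as ℚᵘ using (mkℚᵘ; *≡*)
import Data.Rational.Unnormalised.Properties as ℚᵘₚ
open import Data.Sum using (_⊎_; inj₁; inj₂)
open import Function.Bundles using (_⇔_; mk⇔)
open import Level using (0ℓ)
open import Relation.Binary.PropositionalEquality
open import Relation.Nullary using (yes; no; contradiction)
open import Tactic.RingSolver using (solve-∀; solve)
open import Tactic.RingSolver.Core.AlmostCommutativeRing using (AlmostCommutativeRing; fromCommutativeRing)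

ℚ-ring : AlmostCommutativeRing 0ℓ 0ℓ
ℚ-ring = fromCommutativeRing ℚₚ.+-*-commutativeRing 0≟
  where
  0≟ : (x : ℚ) → Maybe (0ℚ ≡ x)
  0≟ x with 0ℚ ℚₚ.≟ x
  ... | yes 0≡x = just 0≡x
  ... | no _    = nothing

open AlmostCommutativeRing ℚ-ring using (_^_)

-- The embedding ℤ → ℚ

toℚᵘ-ℚof : ∀ n → toℚᵘ (ℚof n) ℚᵘ.≃ mkℚᵘ n 0
toℚᵘ-ℚof n = ℚₚ.toℚᵘ-fromℚᵘ (mkℚᵘ n 0)

ℚof-+ : ∀ m n → ℚof (m ℤ.+ n) ≡ ℚof m + ℚof n
ℚof-+ m n = ℚₚ.toℚᵘ-injective (begin
  toℚᵘ (ℚof (m ℤ.+ n))            ≈⟨ toℚᵘ-ℚof (m ℤ.+ n) ⟩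
  mkℚᵘ (m ℤ.+ n) 0                ≈⟨ *≡* (identity m n) ⟩
  mkℚᵘ m 0 ℚᵘ.+ mkℚᵘ n 0          ≈⟨ ℚᵘₚ.+-cong (toℚᵘ-ℚof m) (toℚᵘ-ℚof n) ⟨
  toℚᵘ (ℚof m) ℚᵘ.+ toℚᵘ (ℚof n)  ≈⟨ ℚₚ.toℚᵘ-homo-+ (ℚof m) (ℚof n) ⟨
  toℚᵘ (ℚof m + ℚof n)            ∎)
  where
  open ℚᵘₚ.≃-Reasoning
  identity : ∀ m n → (m ℤ.+ n) ℤ.* + 1 ≡ (m ℤ.* + 1 ℤ.+ n ℤ.* + 1) ℤ.* + 1
  identity = ℤ-Solver.solve-∀

ℚof-* : ∀ m n → ℚof (m ℤ.* n) ≡ ℚof m * ℚof n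
ℚof-* m n = ℚₚ.toℚᵘ-injective (begin
  toℚᵘ (ℚof (m ℤ.* n))            ≈⟨ toℚᵘ-ℚof (m ℤ.* n) ⟩
  mkℚᵘ (m ℤ.* n) 0                ≈⟨ *≡* refl ⟩
  mkℚᵘ m 0 ℚᵘ.* mkℚᵘ n 0          ≈⟨ ℚᵘₚ.*-cong (toℚᵘ-ℚof m) (toℚᵘ-ℚof n) ⟨
  toℚᵘ (ℚof m) ℚᵘ.* toℚᵘ (ℚof n)  ≈⟨ ℚₚ.toℚᵘ-homo-* (ℚof m) (ℚof n) ⟨
  toℚᵘ (ℚof m * ℚof n)            ∎)
  where open ℚᵘₚ.≃-Reasoning

ℚof-neg : ∀ n → ℚof (ℤ.- n) ≡ - ℚof n
ℚof-neg n = ℚₚ.toℚᵘ-injective (begin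
  toℚᵘ (ℚof (ℤ.- n))   ≈⟨ toℚᵘ-ℚof (ℤ.- n) ⟩
  mkℚᵘ (ℤ.- n) 0       ≈⟨ ℚᵘₚ.-‿cong (toℚᵘ-ℚof n) ⟨
  ℚᵘ.- toℚᵘ (ℚof n)    ≈⟨ ℚₚ.toℚᵘ-homo‿- (ℚof n) ⟨
  toℚᵘ (- ℚof n)       ∎)
  where open ℚᵘₚ.≃-Reasoning

ℚof-- : ∀ m n → ℚof (m ℤ.- n) ≡ ℚof m - ℚof n
ℚof-- m n = trans (ℚof-+ m (ℤ.- n)) (cong (λ x → ℚof m + x) (ℚof-neg n))

ℚof[m*2]*x : ∀ m x → ℚof (m ℤ.* + 2) * x ≡ k (+ 2) * (ℚof m * x)
ℚof[m*2]*x m x = trans (cong (_* x) (ℚof-* m (+ 2))) (identity (ℚof m) x)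
  where
  identity : ∀ a x → a * k (+ 2) * x ≡ k (+ 2) * (a * x)
  identity = solve-∀ ℚ-ring

↥-ℚof : ∀ n → ↥ ℚof n ≡ n
↥-ℚof n = begin
  ↥ ℚof n                        ≡⟨ ℤₚ.*-identityʳ (↥ ℚof n) ⟨
  ↥ ℚof n ℤ.* + 1                ≡⟨ cong (λ g → ↥ ℚof n ℤ.* + g) (ℕ.gcd-zeroʳ ℤ.∣ n ∣) ⟨
  ↥ ℚof n ℤ.* + ℕ.gcd ℤ.∣ n ∣ 1  ≡⟨ ℚₚ.↥-/ n 1 ⟩
  n                              ∎
  where open ≡-Reasoning

↧ₙ-ℚof : ∀ n → ↧ₙ ℚof n ≡ 1
↧ₙ-ℚof n = cong ℤ.∣_∣ (begin
  ↧ ℚof n                        ≡⟨ ℤₚ.*-identityʳ (↧ ℚof n) ⟨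
  ↧ ℚof n ℤ.* + 1                ≡⟨ cong (λ g → ↧ ℚof n ℤ.* + g) (ℕ.gcd-zeroʳ ℤ.∣ n ∣) ⟨
  ↧ ℚof n ℤ.* + ℕ.gcd ℤ.∣ n ∣ 1  ≡⟨ ℚₚ.↧-/ n 1 ⟩
  + 1                            ∎)
  where open ≡-Reasoning

ℚof-injective : ∀ {m n} → ℚof m ≡ ℚof n → m ≡ n
ℚof-injective {m} {n} eq = trans (sym (↥-ℚof m)) (trans (cong ↥_ eq) (↥-ℚof n))

1/suc : ℕ → ℚ
1/suc d = mkℚ (+ 1) d (ℕ.1-coprimeTo (suc d))

ℚof-suc*1/suc≡1 : ∀ d → ℚof (+ suc d) * 1/suc d ≡ 1ℚ
ℚof-suc*1/suc≡1 d = ℚₚ.toℚᵘ-injective (begin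
  toℚᵘ (ℚof (+ suc d) * 1/suc d)            ≈⟨ ℚₚ.toℚᵘ-homo-* (ℚof (+ suc d)) (1/suc d) ⟩
  toℚᵘ (ℚof (+ suc d)) ℚᵘ.* toℚᵘ (1/suc d)  ≈⟨ ℚᵘₚ.*-congʳ (toℚᵘ-ℚof (+ suc d)) ⟩
  mkℚᵘ (+ suc d) 0 ℚᵘ.* mkℚᵘ (+ 1) d        ≈⟨ *≡* (cong (λ x → + suc x) (identity d)) ⟩
  toℚᵘ 1ℚ                                   ∎)
  where
  open ℚᵘₚ.≃-Reasoning
  identity : ∀ d → d ℕ.* 1 ℕ.* 1 ≡ d ℕ.+ 0 ℕ.* suc d ℕ.+ 0 ℕ.* suc (d ℕ.+ 0 ℕ.* suc d)
  identity = ℕ-Solver.solve-∀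

ℚof↥p*1/↧p≡p : ∀ q → ℚof (↥ q) * 1/suc (ℚ.denominator-1 q) ≡ q
ℚof↥p*1/↧p≡p q@(mkℚ n d _) = ℚₚ.toℚᵘ-injective (begin
  toℚᵘ (ℚof n * 1/suc d)            ≈⟨ ℚₚ.toℚᵘ-homo-* (ℚof n) (1/suc d) ⟩
  toℚᵘ (ℚof n) ℚᵘ.* toℚᵘ (1/suc d)  ≈⟨ ℚᵘₚ.*-congʳ (toℚᵘ-ℚof n) ⟩
  mkℚᵘ n 0 ℚᵘ.* mkℚᵘ (+ 1) d        ≈⟨ *≡* (cong₂ ℤ._*_ (ℤₚ.*-identityʳ n) d≡) ⟩
  toℚᵘ q                            ∎)
  where
  open ℚᵘₚ.≃-Reasoning
  d≡ : + suc d ≡ + suc (d ℕ.+ 0)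
  d≡ = cong (λ x → + suc x) (sym (ℕₚ.+-identityʳ d))

-- Odd numbers and the ring ℤ₍₂₎ of 2-integral rationals

Odd : ℕ → Set
Odd n = n ℕ.% 2 ≡ 1

%2≡0⊎Odd : ∀ n → n ℕ.% 2 ≡ 0 ⊎ Odd n
%2≡0⊎Odd n with n ℕ.% 2 | ℕ.m%n<n n 2
... | 0           | _            = inj₁ refl
... | 1           | _            = inj₂ refl
... | suc (suc _) | s≤s (s≤s ())

%2≡suc⇒Odd : ∀ n {j} → n ℕ.% 2 ≡ suc j → Odd n
%2≡suc⇒Odd n n%2≡suc with %2≡0⊎Odd n
... | inj₁ n%2≡0 = contradiction (trans (sym n%2≡suc) n%2≡0) λ ()
... | inj₂ odd   = odd

Odd⇒≢0 : ∀ {n} → Odd n → n ≢ 0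
Odd⇒≢0 odd refl = contradiction odd λ ()

Odd⇒1+[n/2]*2 : ∀ {n} → Odd n → n ≡ 1 ℕ.+ (n ℕ./ 2) ℕ.* 2
Odd⇒1+[n/2]*2 {n} odd = trans (ℕ.m≡m%n+[m/n]*n n 2) (cong (ℕ._+ (n ℕ./ 2) ℕ.* 2) odd)

Odd-* : ∀ m n → Odd m → Odd n → Odd (m ℕ.* n)
Odd-* m n odd-m odd-n = trans (ℕ.%-distribˡ-* m n 2) (cong₂ (λ a b → (a ℕ.* b) ℕ.% 2) odd-m odd-n)

Odd-*⇒Oddˡ : ∀ m n → Odd (m ℕ.* n) → Odd m
Odd-*⇒Oddˡ m n odd with %2≡0⊎Odd m
... | inj₂ odd-m  = odd-m
... | inj₁ even-m = contradiction (trans (sym odd) (trans (ℕ.%-distribˡ-* m n 2)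
                                    (cong (λ a → (a ℕ.* (n ℕ.% 2)) ℕ.% 2) even-m))) λ ()

Integral2-of-↧-factor : ∀ x g {y} → ↧ x ℤ.* g ≡ y → Odd ℤ.∣ y ∣ → Integral2 x
Integral2-of-↧-factor x g eq odd =
  Odd-*⇒Oddˡ (↧ₙ x) ℤ.∣ g ∣ (subst Odd (trans (cong ℤ.∣_∣ (sym eq)) (ℤₚ.abs-* (↧ x) g)) odd)

Integral2-+ : ∀ p q → Integral2 p → Integral2 q → Integral2 (p + q)
Integral2-+ p q p∈ q∈ = Integral2-of-↧-factor (p + q) _ (ℚₚ.↧-+ p q)
  (subst Odd (sym (ℤₚ.abs-* (↧ p) (↧ q))) (Odd-* (↧ₙ p) (↧ₙ q) p∈ q∈))

Integral2-* : ∀ p q → Integral2 p → Integral2 q → Integral2 (p * q)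
Integral2-* p q p∈ q∈ = Integral2-of-↧-factor (p * q) _ (ℚₚ.↧-* p q)
  (subst Odd (sym (ℤₚ.abs-* (↧ p) (↧ q))) (Odd-* (↧ₙ p) (↧ₙ q) p∈ q∈))

Integral2-neg : ∀ p → Integral2 p → Integral2 (- p)
Integral2-neg p p∈ = subst Odd (sym (cong ℤ.∣_∣ (ℚₚ.↧-neg p))) p∈

Integral2-ℚof : ∀ n → Integral2 (ℚof n)
Integral2-ℚof n = cong (ℕ._% 2) (↧ₙ-ℚof n)

record ℤ₍₂₎ : Set where
  constructor ⟨_,_⟩
  field
    val      : ℚ
    integral : Integral2 val
open ℤ₍₂₎ public

infixl 6 _+₂_ _-₂_
infixl 7 _*₂_
infix 8 -₂_

_+₂_ : ℤ₍₂₎ → ℤ₍₂₎ → ℤ₍₂₎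
⟨ p , p∈ ⟩ +₂ ⟨ q , q∈ ⟩ = ⟨ p + q , Integral2-+ p q p∈ q∈ ⟩

_*₂_ : ℤ₍₂₎ → ℤ₍₂₎ → ℤ₍₂₎
⟨ p , p∈ ⟩ *₂ ⟨ q , q∈ ⟩ = ⟨ p * q , Integral2-* p q p∈ q∈ ⟩

-₂_ : ℤ₍₂₎ → ℤ₍₂₎
-₂ ⟨ p , p∈ ⟩ = ⟨ - p , Integral2-neg p p∈ ⟩

_-₂_ : ℤ₍₂₎ → ℤ₍₂₎ → ℤ₍₂₎
x -₂ y = x +₂ -₂ y

ι : ℤ → ℤ₍₂₎
ι n = ⟨ ℚof n , Integral2-ℚof n ⟩

⅓ : ℚ
⅓ = + 1 ℚ./ 3

⅓₂ : ℤ₍₂₎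
⅓₂ = ⟨ ⅓ , refl ⟩

1/suc₂ : ∀ d → Odd (suc d) → ℤ₍₂₎
1/suc₂ d odd = ⟨ 1/suc d , odd ⟩

infix 4 _∣₂_
_∣₂_ : ℚ → ℚ → Set
c ∣₂ q = Σ[ w ∈ ℤ₍₂₎ ] q ≡ c * val w

ℤ-parity : ∀ n → (Σ[ m ∈ ℤ ] n ≡ m ℤ.* + 2) ⊎ (Σ[ m ∈ ℤ ] n ≡ + 1 ℤ.+ m ℤ.* + 2)
ℤ-parity n with n ℤ.%ℕ 2 | ℤ.n%ℕd<d n 2 | ℤ.a≡a%ℕn+[a/ℕn]*n n 2
... | 0           | _            | n≡ = inj₁ (n ℤ./ℕ 2 , trans n≡ (ℤₚ.+-identityˡ _))
... | 1           | _            | n≡ = inj₂ (n ℤ./ℕ 2 , n≡)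
... | suc (suc _) | s≤s (s≤s ()) | _

parity : ∀ q → Integral2 q → k (+ 2) ∣₂ q ⊎ Σ[ w ∈ ℤ₍₂₎ ] q ≡ 1ℚ + k (+ 2) * val w
parity q@(mkℚ n d _) odd-d with ℤ-parity n
... | inj₁ (m , n≡m*2) = inj₁ (ι m *₂ 1/suc₂ d odd-d , (begin
  q                            ≡⟨ ℚof↥p*1/↧p≡p q ⟨
  ℚof n * 1/suc d              ≡⟨ cong (λ x → ℚof x * 1/suc d) n≡m*2 ⟩
  ℚof (m ℤ.* + 2) * 1/suc d    ≡⟨ ℚof[m*2]*x m (1/suc d) ⟩
  k (+ 2) * (ℚof m * 1/suc d)  ∎))
  where open ≡-Reasoning
... | inj₂ (m , n≡1+m*2) = inj₂ (ι m-e *₂ 1/suc₂ d odd-d , (begin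
  q                                                      ≡⟨ ℚof↥p*1/↧p≡p q ⟨
  ℚof n * 1/suc d                                        ≡⟨ cong (λ x → ℚof x * 1/suc d) n≡d+[m-e]*2 ⟩
  ℚof (+ suc d ℤ.+ m-e ℤ.* + 2) * 1/suc d                ≡⟨ cong (_* 1/suc d) (ℚof-+ (+ suc d) (m-e ℤ.* + 2)) ⟩
  (ℚof (+ suc d) + ℚof (m-e ℤ.* + 2)) * 1/suc d          ≡⟨ ℚₚ.*-distribʳ-+ (1/suc d) (ℚof (+ suc d)) _ ⟩
  ℚof (+ suc d) * 1/suc d + ℚof (m-e ℤ.* + 2) * 1/suc d
    ≡⟨ cong₂ _+_ (ℚof-suc*1/suc≡1 d) (ℚof[m*2]*x m-e (1/suc d)) ⟩
  1ℚ + k (+ 2) * (ℚof m-e * 1/suc d)                     ∎))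
  where
  open ≡-Reasoning
  e = suc d ℕ./ 2
  m-e = m ℤ.- + e
  suc-d≡1+e*2 : + suc d ≡ + 1 ℤ.+ + e ℤ.* + 2
  suc-d≡1+e*2 = trans (cong +_ (Odd⇒1+[n/2]*2 odd-d))
                      (trans (ℤₚ.pos-+ 1 (e ℕ.* 2)) (cong (λ x → + 1 ℤ.+ x) (ℤₚ.pos-* e 2)))
  regroup : ∀ m e → + 1 ℤ.+ m ℤ.* + 2 ≡ (+ 1 ℤ.+ e ℤ.* + 2) ℤ.+ (m ℤ.- e) ℤ.* + 2
  regroup = ℤ-Solver.solve-∀
  n≡d+[m-e]*2 : n ≡ + suc d ℤ.+ m-e ℤ.* + 2
  n≡d+[m-e]*2 = trans n≡1+m*2 (trans (regroup m (+ e)) (cong (λ x → x ℤ.+ m-e ℤ.* + 2) (sym suc-d≡1+e*2)))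

-- The 2-adic valuation

2^*odd≢0 : ∀ e {o} → Odd o → 2 ℕ.^ e ℕ.* o ≢ 0
2^*odd≢0 e odd eq with ℕₚ.m*n≡0⇒m≡0∨n≡0 (2 ℕ.^ e) eq
... | inj₁ 2^e≡0 = ℕ.≢-nonZero⁻¹ (2 ℕ.^ e) {{ℕₚ.m^n≢0 2 e}} 2^e≡0
... | inj₂ o≡0   = Odd⇒≢0 odd o≡0

2^[1+e]*o≡2^e*o*2 : ∀ e o → 2 ℕ.^ suc e ℕ.* o ≡ 2 ℕ.^ e ℕ.* o ℕ.* 2
2^[1+e]*o≡2^e*o*2 e o = identity (2 ℕ.^ e) o
  where
  identity : ∀ a o → 2 ℕ.* a ℕ.* o ≡ a ℕ.* o ℕ.* 2
  identity = ℕ-Solver.solve-∀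

[1+m]/2≤f : ∀ {m f} → suc m ℕ.≤ suc f → suc m ℕ./ 2 ℕ.≤ f
[1+m]/2≤f {m} 1+m≤1+f = ℕₚ.≤-pred (ℕₚ.<-≤-trans (ℕ.m/n<m (suc m) 2 (s≤s (s≤s z≤n))) 1+m≤1+f)

v2-go-2^*odd : ∀ f e {o n} → Odd o → n ≡ 2 ℕ.^ e ℕ.* o → n ℕ.≤ f → v2-go f n ≡ e
v2-go-2^*odd zero    e odd n≡ z≤n         = contradiction (sym n≡) (2^*odd≢0 e odd)
v2-go-2^*odd (suc f) e {n = zero} odd n≡ _ = contradiction (sym n≡) (2^*odd≢0 e odd)
v2-go-2^*odd (suc f) e {o} {suc m} odd n≡ n≤ with suc m ℕ.% 2 in n%2 | e
... | zero  | zero  = contradiction (trans (sym n%2) (subst Odd (sym (trans n≡ (ℕₚ.*-identityˡ o))) odd)) λ ()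
... | zero  | suc e = cong suc (v2-go-2^*odd f e odd half≡ ([1+m]/2≤f n≤))
  where
  half≡ : suc m ℕ./ 2 ≡ 2 ℕ.^ e ℕ.* o
  half≡ = trans (cong (ℕ._/ 2) (trans n≡ (2^[1+e]*o≡2^e*o*2 e o))) (ℕ.m*n/n≡m (2 ℕ.^ e ℕ.* o) 2)
... | suc _ | zero  = refl
... | suc _ | suc e = contradiction (trans (sym (%2≡suc⇒Odd (suc m) n%2)) n%2≡0) λ ()
  where
  n%2≡0 : suc m ℕ.% 2 ≡ 0
  n%2≡0 = trans (cong (ℕ._% 2) (trans n≡ (2^[1+e]*o≡2^e*o*2 e o))) (ℕ.m*n%n≡0 (2 ℕ.^ e ℕ.* o) 2)

v2-go-decomposition : ∀ f n → n ≢ 0 → n ℕ.≤ f → Σ[ o ∈ ℕ ] Odd o × n ≡ 2 ℕ.^ v2-go f n ℕ.* o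
v2-go-decomposition zero    n       n≢0 z≤n = contradiction refl n≢0
v2-go-decomposition (suc f) zero    n≢0 _   = contradiction refl n≢0
v2-go-decomposition (suc f) (suc m) _   n≤ with suc m ℕ.% 2 in n%2
... | suc _ = suc m , %2≡suc⇒Odd (suc m) n%2 , sym (ℕₚ.*-identityˡ (suc m))
... | zero with v2-go-decomposition f (suc m ℕ./ 2) half≢0 ([1+m]/2≤f n≤)
  where
  half≢0 : suc m ℕ./ 2 ≢ 0
  half≢0 half≡0 = contradiction
    (trans (ℕ.m≡m%n+[m/n]*n (suc m) 2) (cong₂ (λ r h → r ℕ.+ h ℕ.* 2) n%2 half≡0)) λ ()
...   | o , odd , half≡ = o , odd , (begin
  suc m                                ≡⟨ ℕ.m≡m%n+[m/n]*n (suc m) 2 ⟩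
  suc m ℕ.% 2 ℕ.+ suc m ℕ./ 2 ℕ.* 2    ≡⟨ cong₂ (λ r h → r ℕ.+ h ℕ.* 2) n%2 half≡ ⟩
  2 ℕ.^ v ℕ.* o ℕ.* 2                  ≡⟨ 2^[1+e]*o≡2^e*o*2 v o ⟨
  2 ℕ.^ suc v ℕ.* o                    ∎)
  where
  open ≡-Reasoning
  v = v2-go f (suc m ℕ./ 2)

v2ℕ-2^*odd : ∀ e o → Odd o → v2ℕ (2 ℕ.^ e ℕ.* o) ≡ e
v2ℕ-2^*odd e o odd = v2-go-2^*odd _ e odd refl ℕₚ.≤-refl

v2ℕ-odd : ∀ o → Odd o → v2ℕ o ≡ 0
v2ℕ-odd o odd = trans (cong v2ℕ (sym (ℕₚ.+-identityʳ o))) (v2ℕ-2^*odd 0 o odd)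

v2ℕ-decomposition : ∀ {n} → n ≢ 0 → Σ[ o ∈ ℕ ] Odd o × n ≡ 2 ℕ.^ v2ℕ n ℕ.* o
v2ℕ-decomposition {n} n≢0 = v2-go-decomposition n n n≢0 ℕₚ.≤-refl

v2ℕ-* : ∀ {m n} → m ≢ 0 → n ≢ 0 → v2ℕ (m ℕ.* n) ≡ v2ℕ m ℕ.+ v2ℕ n
v2ℕ-* {m} {n} m≢0 n≢0 with v2ℕ-decomposition m≢0 | v2ℕ-decomposition n≢0
... | o , odd , m≡ | o′ , odd′ , n≡ = begin
  v2ℕ (m ℕ.* n)                              ≡⟨ cong₂ (λ x y → v2ℕ (x ℕ.* y)) m≡ n≡ ⟩
  v2ℕ (2 ℕ.^ a ℕ.* o ℕ.* (2 ℕ.^ b ℕ.* o′))   ≡⟨ cong v2ℕ (regroup (2 ℕ.^ a) (2 ℕ.^ b) o o′) ⟩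
  v2ℕ (2 ℕ.^ a ℕ.* 2 ℕ.^ b ℕ.* (o ℕ.* o′))   ≡⟨ cong (λ x → v2ℕ (x ℕ.* (o ℕ.* o′))) (ℕₚ.^-distribˡ-+-* 2 a b) ⟨
  v2ℕ (2 ℕ.^ (a ℕ.+ b) ℕ.* (o ℕ.* o′))       ≡⟨ v2ℕ-2^*odd (a ℕ.+ b) (o ℕ.* o′) (Odd-* o o′ odd odd′) ⟩
  a ℕ.+ b                                    ∎
  where
  open ≡-Reasoning
  a = v2ℕ m
  b = v2ℕ n
  regroup : ∀ x y o o′ → x ℕ.* o ℕ.* (y ℕ.* o′) ≡ x ℕ.* y ℕ.* (o ℕ.* o′)
  regroup = ℕ-Solver.solve-∀

v2ℕ-*-cross : ∀ a g c d → a ℕ.* g ≡ c ℕ.* d → c ≢ 0 → d ≢ 0 → v2ℕ a ℕ.+ v2ℕ g ≡ v2ℕ c ℕ.+ v2ℕ d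
v2ℕ-*-cross a g c d ag≡cd c≢0 d≢0 = begin
  v2ℕ a ℕ.+ v2ℕ g  ≡⟨ v2ℕ-* a≢0 g≢0 ⟨
  v2ℕ (a ℕ.* g)    ≡⟨ cong v2ℕ ag≡cd ⟩
  v2ℕ (c ℕ.* d)    ≡⟨ v2ℕ-* c≢0 d≢0 ⟩
  v2ℕ c ℕ.+ v2ℕ d  ∎
  where
  open ≡-Reasoning
  cd≢0 : c ℕ.* d ≢ 0
  cd≢0 cd≡0 with ℕₚ.m*n≡0⇒m≡0∨n≡0 c cd≡0
  ... | inj₁ c≡0 = c≢0 c≡0
  ... | inj₂ d≡0 = d≢0 d≡0
  a≢0 : a ≢ 0
  a≢0 refl = cd≢0 (sym ag≡cd)
  g≢0 : g ≢ 0
  g≢0 refl = cd≢0 (trans (sym ag≡cd) (ℕₚ.*-zeroʳ a))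

2^∣-of-≤v2ℕ : ∀ {j n} → n ≢ 0 → j ℕ.≤ v2ℕ n → 2 ℕ.^ j ℕ.∣ n
2^∣-of-≤v2ℕ {j} {n} n≢0 j≤v with v2ℕ-decomposition n≢0
... | o , _ , n≡ = subst (2 ℕ.^ j ℕ.∣_) (sym n≡) (ℕ.∣-trans 2^j∣2^v (ℕ.m∣m*n o))
  where
  2^j∣2^v : 2 ℕ.^ j ℕ.∣ 2 ℕ.^ v2ℕ n
  2^j∣2^v = subst (2 ℕ.^ j ℕ.∣_)
    (trans (sym (ℕₚ.^-distribˡ-+-* 2 j (v2ℕ n ℕ.∸ j))) (cong (2 ℕ.^_) (ℕₚ.m+[n∸m]≡n j≤v)))
    (ℕ.m∣m*n (2 ℕ.^ (v2ℕ n ℕ.∸ j)))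

v2ℚ-cross : ∀ x p q g → ↥ x ℤ.* g ≡ ↥ p ℤ.* ↥ q → ↧ x ℤ.* g ≡ ↧ p ℤ.* ↧ q → p ≢ 0ℚ → q ≢ 0ℚ →
            v2ℚ x ≡ v2ℚ p ℤ.+ v2ℚ q
v2ℚ-cross x p q g ↥-eq ↧-eq p≢0 q≢0 =
  difference (v2ℕ ∣↥x∣) (v2ℕ (↧ₙ x)) (v2ℕ ∣↥p∣) (v2ℕ ∣↥q∣) (v2ℕ (↧ₙ p)) (v2ℕ (↧ₙ q)) (v2ℕ ℤ.∣ g ∣)
    (v2ℕ-*-cross ∣↥x∣ ℤ.∣ g ∣ ∣↥p∣ ∣↥q∣ (∣∣-* (↥ x) g (↥ p) (↥ q) ↥-eq) (∣↥∣≢0 p p≢0) (∣↥∣≢0 q q≢0))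
    (v2ℕ-*-cross (↧ₙ x) ℤ.∣ g ∣ (↧ₙ p) (↧ₙ q) (∣∣-* (↧ x) g (↧ p) (↧ q) ↧-eq) (λ ()) (λ ()))
  where
  ∣↥x∣ = ℤ.∣ ↥ x ∣
  ∣↥p∣ = ℤ.∣ ↥ p ∣
  ∣↥q∣ = ℤ.∣ ↥ q ∣
  ∣↥∣≢0 : ∀ y → y ≢ 0ℚ → ℤ.∣ ↥ y ∣ ≢ 0
  ∣↥∣≢0 y y≢0 ∣↥y∣≡0 = y≢0 (ℚₚ.↥p≡0⇒p≡0 y (ℤₚ.∣i∣≡0⇒i≡0 ∣↥y∣≡0))
  ∣∣-* : ∀ a b c d → a ℤ.* b ≡ c ℤ.* d → ℤ.∣ a ∣ ℕ.* ℤ.∣ b ∣ ≡ ℤ.∣ c ∣ ℕ.* ℤ.∣ d ∣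
  ∣∣-* a b c d eq = trans (sym (ℤₚ.abs-* a b)) (trans (cong ℤ.∣_∣ eq) (ℤₚ.abs-* c d))
  difference : ∀ a b c d e f g → a ℕ.+ g ≡ c ℕ.+ d → b ℕ.+ g ≡ e ℕ.+ f →
               + a ℤ.- + b ≡ (+ c ℤ.- + e) ℤ.+ (+ d ℤ.- + f)
  difference a b c d e f g a+g≡c+d b+g≡e+f = begin
    + a ℤ.- + b                      ≡⟨ shift (+ a) (+ b) (+ g) ⟩
    (+ a ℤ.+ + g) ℤ.- (+ b ℤ.+ + g)  ≡⟨ cong₂ ℤ._-_ (lift a g c d a+g≡c+d) (lift b g e f b+g≡e+f) ⟩
    (+ c ℤ.+ + d) ℤ.- (+ e ℤ.+ + f)  ≡⟨ regroup (+ c) (+ d) (+ e) (+ f) ⟩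
    (+ c ℤ.- + e) ℤ.+ (+ d ℤ.- + f)  ∎
    where
    open ≡-Reasoning
    lift : ∀ m n r s → m ℕ.+ n ≡ r ℕ.+ s → + m ℤ.+ + n ≡ + r ℤ.+ + s
    lift m n r s eq = trans (sym (ℤₚ.pos-+ m n)) (trans (cong +_ eq) (ℤₚ.pos-+ r s))
    shift : ∀ a b g → a ℤ.- b ≡ (a ℤ.+ g) ℤ.- (b ℤ.+ g)
    shift = ℤ-Solver.solve-∀
    regroup : ∀ c d e f → (c ℤ.+ d) ℤ.- (e ℤ.+ f) ≡ (c ℤ.- e) ℤ.+ (d ℤ.- f)
    regroup = ℤ-Solver.solve-∀

v2ℚ-* : ∀ p q → p * q ≢ 0ℚ → v2ℚ (p * q) ≡ v2ℚ p ℤ.+ v2ℚ q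
v2ℚ-* p q pq≢0 = v2ℚ-cross (p * q) p q _ (ℚₚ.↥-* p q) (ℚₚ.↧-* p q) p≢0 q≢0
  where
  p≢0 : p ≢ 0ℚ
  p≢0 refl = pq≢0 (ℚₚ.*-zeroˡ q)
  q≢0 : q ≢ 0ℚ
  q≢0 refl = pq≢0 (ℚₚ.*-zeroʳ p)

v2ℚ-^ : ∀ u n → u ^ suc n ≢ 0ℚ → v2ℚ (u ^ suc n) ≡ + suc n ℤ.* v2ℚ u
v2ℚ-^ u zero    _      = sym (ℤₚ.*-identityˡ (v2ℚ u))
v2ℚ-^ u (suc n) uⁿ⁺²≢0 = begin
  v2ℚ (u ^ suc n * u)           ≡⟨ v2ℚ-* (u ^ suc n) u uⁿ⁺²≢0 ⟩
  v2ℚ (u ^ suc n) ℤ.+ v2ℚ u     ≡⟨ cong (ℤ._+ v2ℚ u) (v2ℚ-^ u n uⁿ⁺¹≢0) ⟩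
  + suc n ℤ.* v2ℚ u ℤ.+ v2ℚ u   ≡⟨ identity (+ suc n) (v2ℚ u) ⟩
  (+ 1 ℤ.+ + suc n) ℤ.* v2ℚ u   ∎
  where
  open ≡-Reasoning
  uⁿ⁺¹≢0 : u ^ suc n ≢ 0ℚ
  uⁿ⁺¹≢0 uⁿ⁺¹≡0 = uⁿ⁺²≢0 (trans (cong (_* u) uⁿ⁺¹≡0) (ℚₚ.*-zeroˡ u))
  identity : ∀ m v → m ℤ.* v ℤ.+ v ≡ (+ 1 ℤ.+ m) ℤ.* v
  identity = ℤ-Solver.solve-∀

v2ℚ-ℚof : ∀ n → v2ℚ (ℚof n) ≡ + v2ℕ ℤ.∣ n ∣
v2ℚ-ℚof n = begin
  + v2ℕ ℤ.∣ ↥ ℚof n ∣ ℤ.- + v2ℕ (↧ₙ ℚof n)  ≡⟨ cong₂ (λ a b → + v2ℕ ℤ.∣ a ∣ ℤ.- + v2ℕ b) (↥-ℚof n) (↧ₙ-ℚof n) ⟩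
  + v2ℕ ℤ.∣ n ∣ ℤ.- + 0                     ≡⟨ ℤₚ.+-identityʳ (+ v2ℕ ℤ.∣ n ∣) ⟩
  + v2ℕ ℤ.∣ n ∣                             ∎
  where open ≡-Reasoning

Integral2⇒0≤v2ℚ : ∀ q → Integral2 q → + 0 ℤ.≤ v2ℚ q
Integral2⇒0≤v2ℚ q odd = subst (+ 0 ℤ.≤_) (sym v2ℚ≡) (+≤+ z≤n)
  where
  v2ℚ≡ : v2ℚ q ≡ + v2ℕ ℤ.∣ ↥ q ∣
  v2ℚ≡ = trans (cong (λ b → + v2ℕ ℤ.∣ ↥ q ∣ ℤ.- + b) (v2ℕ-odd (↧ₙ q) odd)) (ℤₚ.+-identityʳ _)

1≤v2ℚ⇒2∣₂ : ∀ u → + 1 ℤ.≤ v2ℚ u → k (+ 2) ∣₂ u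
1≤v2ℚ⇒2∣₂ u@(mkℚ n d coprime) 1≤v2u = ι m *₂ 1/suc₂ d odd-d , (begin
  u                            ≡⟨ ℚof↥p*1/↧p≡p u ⟨
  ℚof n * 1/suc d              ≡⟨ cong (λ x → ℚof x * 1/suc d) n≡m*2 ⟩
  ℚof (m ℤ.* + 2) * 1/suc d    ≡⟨ ℚof[m*2]*x m (1/suc d) ⟩
  k (+ 2) * (ℚof m * 1/suc d)  ∎)
  where
  open ≡-Reasoning
  1≤a : ∀ a b → + 1 ℤ.≤ + a ℤ.- + b → 1 ℕ.≤ a
  1≤a zero    zero    (+≤+ ())
  1≤a zero    (suc b) ()
  1≤a (suc a) b       _ = s≤s z≤n
  1≤v2ℕ∣n∣ : 1 ℕ.≤ v2ℕ ℤ.∣ n ∣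
  1≤v2ℕ∣n∣ = 1≤a (v2ℕ ℤ.∣ n ∣) (v2ℕ (suc d)) 1≤v2u
  ∣n∣≢0 : ℤ.∣ n ∣ ≢ 0
  ∣n∣≢0 ∣n∣≡0 = contradiction (subst (λ x → 1 ℕ.≤ v2ℕ x) ∣n∣≡0 1≤v2ℕ∣n∣) λ ()
  2∣∣n∣ : 2 ℕ.∣ ℤ.∣ n ∣
  2∣∣n∣ = 2^∣-of-≤v2ℕ ∣n∣≢0 1≤v2ℕ∣n∣
  odd-d : Odd (suc d)
  odd-d with %2≡0⊎Odd (suc d)
  ... | inj₂ odd  = odd
  ... | inj₁ even = contradiction (ℕ.recompute coprime (2∣∣n∣ , ℕ.m%n≡0⇒n∣m (suc d) 2 even)) λ ()
  m : ℤ
  m = Signed._∣_.quotient (Signed.∣ᵤ⇒∣ {+ 2} {n} 2∣∣n∣)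
  n≡m*2 : n ≡ m ℤ.* + 2
  n≡m*2 = Signed._∣_.equality (Signed.∣ᵤ⇒∣ {+ 2} {n} 2∣∣n∣)

2^j∣₂ℚof⇒2^j∣ : ∀ j x → k (+ (2 ℕ.^ j)) ∣₂ ℚof x → + (2 ℕ.^ j) ∣ x
2^j∣₂ℚof⇒2^j∣ j x (w , x≡2^j*w) with x ℤₚ.≟ + 0
... | yes refl = (2 ℕ.^ j) ℕ.∣0
... | no  x≢0  = 2^∣-of-≤v2ℕ (λ ∣x∣≡0 → x≢0 (ℤₚ.∣i∣≡0⇒i≡0 ∣x∣≡0)) (ℤₚ.drop‿+≤+ j≤v2x)
  where
  open ℤₚ.≤-Reasoning
  2^j*w≢0 : k (+ (2 ℕ.^ j)) * val w ≢ 0ℚ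
  2^j*w≢0 eq = x≢0 (ℚof-injective (trans x≡2^j*w eq))
  v2-2^j : v2ℚ (k (+ (2 ℕ.^ j))) ≡ + j
  v2-2^j = trans (v2ℚ-ℚof (+ (2 ℕ.^ j)))
                 (cong +_ (trans (cong v2ℕ (sym (ℕₚ.*-identityʳ (2 ℕ.^ j)))) (v2ℕ-2^*odd j 1 refl)))
  j≤v2x : + j ℤ.≤ + v2ℕ ℤ.∣ x ∣
  j≤v2x = begin
    + j                                    ≡⟨ ℤₚ.+-identityʳ (+ j) ⟨
    + j ℤ.+ + 0                            ≤⟨ ℤₚ.+-monoʳ-≤ (+ j) (Integral2⇒0≤v2ℚ (val w) (integral w)) ⟩
    + j ℤ.+ v2ℚ (val w)                    ≡⟨ cong (ℤ._+ v2ℚ (val w)) v2-2^j ⟨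
    v2ℚ (k (+ (2 ℕ.^ j))) ℤ.+ v2ℚ (val w)  ≡⟨ v2ℚ-* (k (+ (2 ℕ.^ j))) (val w) 2^j*w≢0 ⟨
    v2ℚ (k (+ (2 ℕ.^ j)) * val w)          ≡⟨ cong v2ℚ x≡2^j*w ⟨
    v2ℚ (ℚof x)                            ≡⟨ v2ℚ-ℚof x ⟩
    + v2ℕ ℤ.∣ x ∣                          ∎

∣⇒ℚof≡ : ∀ n x → + n ∣ x → Σ[ q ∈ ℤ ] ℚof x ≡ k (+ n) * ℚof q
∣⇒ℚof≡ n x n∣x with Signed.∣ᵤ⇒∣ {+ n} {x} n∣x
... | Signed.divides q x≡q*n = q , (begin
  ℚof x            ≡⟨ cong ℚof x≡q*n ⟩
  ℚof (q ℤ.* + n)  ≡⟨ ℚof-* q (+ n) ⟩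
  ℚof q * k (+ n)  ≡⟨ ℚₚ.*-comm (ℚof q) (k (+ n)) ⟩
  k (+ n) * ℚof q  ∎)
  where open ≡-Reasoning

∣-⇒ℚof≡ : ∀ n x c → + n ∣ (x ℤ.- c) → Σ[ q ∈ ℤ ] ℚof x ≡ ℚof c + k (+ n) * ℚof q
∣-⇒ℚof≡ n x c n∣x-c with ∣⇒ℚof≡ n (x ℤ.- c) n∣x-c
... | q , x-c≡n*q = q , (begin
  ℚof x                    ≡⟨ identity (ℚof x) (ℚof c) ⟩
  ℚof c + (ℚof x - ℚof c)  ≡⟨ cong (λ y → ℚof c + y) (ℚof-- x c) ⟨
  ℚof c + ℚof (x ℤ.- c)    ≡⟨ cong (λ y → ℚof c + y) x-c≡n*q ⟩
  ℚof c + k (+ n) * ℚof q  ∎)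
  where
  open ≡-Reasoning
  identity : ∀ x c → x ≡ c + (x - c)
  identity = solve-∀ ℚ-ring

-- Changes of variables and the discriminant

shift : ℚ → ℚ → ℚ → Model → Model
shift r s t E = model
  (a1 E + k (+ 2) * s)
  (a2 E - s * a1 E + k (+ 3) * r - s * s)
  (a3 E + r * a1 E + k (+ 2) * t)
  (a4 E - s * a3 E + k (+ 2) * r * a2 E - (t + r * s) * a1 E + k (+ 3) * r * r - k (+ 2) * s * t)
  (a6 E + r * a4 E + r * r * a2 E + r * r * r - t * a3 E - t * t - r * t * a1 E)

-- The powers of u are spelled out as in Transforms, whose equations are then literally the
-- components of scale u E' ≡ shift r s t E.
scale : ℚ → Model → Model
scale u E = model (u * a1 E) (u * u * a2 E) (u * u * u * a3 E) (u * u * u * u * a4 E)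
  (u * u * u * u * u * u * a6 E)

model-≡ : ∀ {x₁ x₂ x₃ x₄ x₆ y₁ y₂ y₃ y₄ y₆} → x₁ ≡ y₁ → x₂ ≡ y₂ → x₃ ≡ y₃ → x₄ ≡ y₄ → x₆ ≡ y₆ →
          model x₁ x₂ x₃ x₄ x₆ ≡ model y₁ y₂ y₃ y₄ y₆
model-≡ refl refl refl refl refl = refl

scale≡shift⇒Transforms : ∀ E E' u r s t → u ≢ 0ℚ → scale u E' ≡ shift r s t E → Transforms E E'
scale≡shift⇒Transforms E E' u r s t u≢0 eq =
  u , r , s , t , u≢0 , cong a1 eq , cong a2 eq , cong a3 eq , cong a4 eq , cong a6 eq

-- disc does not unfold under the reflective solver, so these identities are stated over Expr.
module Discriminant where
  open import Tactic.RingSolver.NonReflective ℚ-ring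
    using (Expr; Κ; _⊕_; _⊗_; ⊝_; _⊛_; _⊜_) renaming (solve to solve-expr)

  discExpr : ∀ {n} → (A₁ A₂ A₃ A₄ A₆ : Expr ℚ n) → Expr ℚ n
  discExpr A₁ A₂ A₃ A₄ A₆ =
    ⊝ (b₂ ⊗ b₂ ⊗ b₈) ⊕ ⊝ (Κ (k (+ 8)) ⊗ b₄ ⊗ b₄ ⊗ b₄) ⊕ ⊝ (Κ (k (+ 27)) ⊗ b₆ ⊗ b₆)
      ⊕ Κ (k (+ 9)) ⊗ b₂ ⊗ b₄ ⊗ b₆
    where
    b₂ = A₁ ⊗ A₁ ⊕ Κ (k (+ 4)) ⊗ A₂
    b₄ = Κ (k (+ 2)) ⊗ A₄ ⊕ A₁ ⊗ A₃
    b₆ = A₃ ⊗ A₃ ⊕ Κ (k (+ 4)) ⊗ A₆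
    b₈ = A₁ ⊗ A₁ ⊗ A₆ ⊕ Κ (k (+ 4)) ⊗ A₂ ⊗ A₆ ⊕ ⊝ (A₁ ⊗ A₃ ⊗ A₄) ⊕ A₂ ⊗ A₃ ⊗ A₃ ⊕ ⊝ (A₄ ⊗ A₄)

  disc-scale : ∀ u E → disc (scale u E) ≡ u ^ 12 * disc E
  disc-scale u E = solve-expr 6 (λ u A₁ A₂ A₃ A₄ A₆ →
    discExpr (u ⊗ A₁) (u ⊗ u ⊗ A₂) (u ⊗ u ⊗ u ⊗ A₃) (u ⊗ u ⊗ u ⊗ u ⊗ A₄) (u ⊗ u ⊗ u ⊗ u ⊗ u ⊗ u ⊗ A₆)
      ⊜ u ⊛ 12 ⊗ discExpr A₁ A₂ A₃ A₄ A₆)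
    refl u (a1 E) (a2 E) (a3 E) (a4 E) (a6 E)

  disc-shift : ∀ r s t E → disc (shift r s t E) ≡ disc E
  disc-shift r s t E = solve-expr 8 (λ r s t A₁ A₂ A₃ A₄ A₆ →
    discExpr
      (A₁ ⊕ Κ (k (+ 2)) ⊗ s)
      (A₂ ⊕ ⊝ (s ⊗ A₁) ⊕ Κ (k (+ 3)) ⊗ r ⊕ ⊝ (s ⊗ s))
      (A₃ ⊕ r ⊗ A₁ ⊕ Κ (k (+ 2)) ⊗ t)
      (A₄ ⊕ ⊝ (s ⊗ A₃) ⊕ Κ (k (+ 2)) ⊗ r ⊗ A₂ ⊕ ⊝ ((t ⊕ r ⊗ s) ⊗ A₁) ⊕ Κ (k (+ 3)) ⊗ r ⊗ r
         ⊕ ⊝ (Κ (k (+ 2)) ⊗ s ⊗ t))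
      (A₆ ⊕ r ⊗ A₄ ⊕ r ⊗ r ⊗ A₂ ⊕ r ⊗ r ⊗ r ⊕ ⊝ (t ⊗ A₃) ⊕ ⊝ (t ⊗ t) ⊕ ⊝ (r ⊗ t ⊗ A₁))
      ⊜ discExpr A₁ A₂ A₃ A₄ A₆)
    refl r s t (a1 E) (a2 E) (a3 E) (a4 E) (a6 E)

  disc-of-short : ∀ A₄ A₆ →
    disc (model 0ℚ 0ℚ 0ℚ A₄ A₆) ≡ - (k (+ 16) * (k (+ 4) * A₄ * A₄ * A₄ + k (+ 27) * A₆ * A₆))
  disc-of-short = solve-expr 2 (λ A₄ A₆ →
    discExpr (Κ 0ℚ) (Κ 0ℚ) (Κ 0ℚ) A₄ A₆
      ⊜ ⊝ (Κ (k (+ 16)) ⊗ (Κ (k (+ 4)) ⊗ A₄ ⊗ A₄ ⊗ A₄ ⊕ Κ (k (+ 27)) ⊗ A₆ ⊗ A₆)))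
    refl

open Discriminant using (disc-scale; disc-shift; disc-of-short)

disc-invariance : ∀ E E' u r s t → scale u E' ≡ shift r s t E → disc E ≡ u ^ 12 * disc E'
disc-invariance E E' u r s t eq = begin
  disc E                ≡⟨ disc-shift r s t E ⟨
  disc (shift r s t E)  ≡⟨ cong disc eq ⟨
  disc (scale u E')     ≡⟨ disc-scale u E' ⟩
  u ^ 12 * disc E'      ∎
  where open ≡-Reasoning

disc-short : ∀ a₄ a₆ → disc (short a₄ a₆) ≡ ℚof (Δshort a₄ a₆)
disc-short a₄ a₆ = begin
  disc (short a₄ a₆)                                            ≡⟨ disc-of-short A₄ A₆ ⟩
  - (k (+ 16) * (k (+ 4) * A₄ * A₄ * A₄ + k (+ 27) * A₆ * A₆))
    ≡⟨ cong₂ (λ x y → - (k (+ 16) * (x + y))) 4a₄³ 27a₆² ⟨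
  - (k (+ 16) * (ℚof P + ℚof R))                                ≡⟨ cong (λ x → - (k (+ 16) * x)) (ℚof-+ P R) ⟨
  - (k (+ 16) * ℚof (P ℤ.+ R))                                  ≡⟨ cong -_ (ℚof-* (+ 16) (P ℤ.+ R)) ⟨
  - ℚof (+ 16 ℤ.* (P ℤ.+ R))                                    ≡⟨ ℚof-neg (+ 16 ℤ.* (P ℤ.+ R)) ⟨
  ℚof (Δshort a₄ a₆)                                            ∎
  where
  open ≡-Reasoning
  A₄ = ℚof a₄
  A₆ = ℚof a₆
  P = + 4 ℤ.* a₄ ℤ.* a₄ ℤ.* a₄
  R = + 27 ℤ.* a₆ ℤ.* a₆
  4a₄³ : ℚof P ≡ k (+ 4) * A₄ * A₄ * A₄
  4a₄³ = trans (ℚof-* (+ 4 ℤ.* a₄ ℤ.* a₄) a₄)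
               (cong (_* A₄) (trans (ℚof-* (+ 4 ℤ.* a₄) a₄) (cong (_* A₄) (ℚof-* (+ 4) a₄))))
  27a₆² : ℚof R ≡ k (+ 27) * A₆ * A₆
  27a₆² = trans (ℚof-* (+ 27 ℤ.* a₆) a₆) (cong (_* A₆) (ℚof-* (+ 27) a₆))

Integral2-disc : ∀ E → IntegralModel2 E → Integral2 (disc E)
Integral2-disc E (i₁ , i₂ , i₃ , i₄ , i₆) = integral
  (-₂ (b₂ *₂ b₂ *₂ b₈) -₂ ι (+ 8) *₂ b₄ *₂ b₄ *₂ b₄ -₂ ι (+ 27) *₂ b₆ *₂ b₆ +₂ ι (+ 9) *₂ b₂ *₂ b₄ *₂ b₆)
  where
  A₁ = ⟨ a1 E , i₁ ⟩
  A₂ = ⟨ a2 E , i₂ ⟩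
  A₃ = ⟨ a3 E , i₃ ⟩
  A₄ = ⟨ a4 E , i₄ ⟩
  A₆ = ⟨ a6 E , i₆ ⟩
  b₂ = A₁ *₂ A₁ +₂ ι (+ 4) *₂ A₂
  b₄ = ι (+ 2) *₂ A₄ +₂ A₁ *₂ A₃
  b₆ = A₃ *₂ A₃ +₂ ι (+ 4) *₂ A₆
  b₈ = A₁ *₂ A₁ *₂ A₆ +₂ ι (+ 4) *₂ A₂ *₂ A₆ -₂ A₁ *₂ A₃ *₂ A₄ +₂ A₂ *₂ A₃ *₂ A₃ -₂ A₄ *₂ A₄


v2ℚ-u¹²* : ∀ u D → u ^ 12 * D ≢ 0ℚ → v2ℚ (u ^ 12 * D) ≡ + 12 ℤ.* v2ℚ u ℤ.+ v2ℚ D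
v2ℚ-u¹²* u D u¹²D≢0 = trans (v2ℚ-* (u ^ 12) D u¹²D≢0) (cong (ℤ._+ v2ℚ D) (v2ℚ-^ u 11 u¹²≢0))
  where
  u¹²≢0 : u ^ 12 ≢ 0ℚ
  u¹²≢0 u¹²≡0 = u¹²D≢0 (trans (cong (_* D) u¹²≡0) (ℚₚ.*-zeroˡ D))

y<12x+y⇒1≤x : ∀ x y → y ℤ.< + 12 ℤ.* x ℤ.+ y → + 1 ℤ.≤ x
y<12x+y⇒1≤x x y y<12x+y with x ℤₚ.≤? + 0
... | no  x≰0 = 0<⇒1≤ (ℤₚ.≰⇒> x≰0)
  where
  0<⇒1≤ : ∀ {x} → + 0 ℤ.< x → + 1 ℤ.≤ x
  0<⇒1≤ (+<+ 0<n) = +≤+ 0<n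
... | yes x≤0 = contradiction y<12x+y (ℤₚ.≤⇒≯ (begin
  + 12 ℤ.* x ℤ.+ y  ≤⟨ ℤₚ.+-monoˡ-≤ y (ℤₚ.*-monoˡ-≤-nonNeg (+ 12) x≤0) ⟩
  + 0 ℤ.+ y         ≡⟨ ℤₚ.+-identityˡ y ⟩
  y                 ∎))
  where open ℤₚ.≤-Reasoning

1≤x⇒12≤12x+y : ∀ x y → + 1 ℤ.≤ x → + 0 ℤ.≤ y → + 12 ℤ.≤ + 12 ℤ.* x ℤ.+ y
1≤x⇒12≤12x+y x y 1≤x 0≤y = begin
  + 12 ℤ.+ + 0      ≤⟨ ℤₚ.+-mono-≤ (ℤₚ.*-monoˡ-≤-nonNeg (+ 12) 1≤x) 0≤y ⟩
  + 12 ℤ.* x ℤ.+ y  ∎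
  where open ℤₚ.≤-Reasoning

v2-drop⇒1≤v2u×12≤v2Δ : ∀ E E' u r s t → IntegralModel2 E' → disc E ≢ 0ℚ → scale u E' ≡ shift r s t E →
                        v2ℚ (disc E') ℤ.< v2ℚ (disc E) → + 1 ℤ.≤ v2ℚ u × + 12 ℤ.≤ v2ℚ (disc E)
v2-drop⇒1≤v2u×12≤v2Δ E E' u r s t E'-integral ΔE≢0 eq v2-drop =
  1≤v2u , subst (+ 12 ℤ.≤_) (sym v2ΔE≡) (1≤x⇒12≤12x+y (v2ℚ u) (v2ℚ (disc E')) 1≤v2u 0≤v2ΔE')
  where
  ΔE≡u¹²ΔE' : disc E ≡ u ^ 12 * disc E'
  ΔE≡u¹²ΔE' = disc-invariance E E' u r s t eq
  v2ΔE≡ : v2ℚ (disc E) ≡ + 12 ℤ.* v2ℚ u ℤ.+ v2ℚ (disc E')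
  v2ΔE≡ = trans (cong v2ℚ ΔE≡u¹²ΔE') (v2ℚ-u¹²* u (disc E') (subst (_≢ 0ℚ) ΔE≡u¹²ΔE' ΔE≢0))
  0≤v2ΔE' : + 0 ℤ.≤ v2ℚ (disc E')
  0≤v2ΔE' = Integral2⇒0≤v2ℚ (disc E') (Integral2-disc E' E'-integral)
  1≤v2u : + 1 ℤ.≤ v2ℚ u
  1≤v2u = y<12x+y⇒1≤x (v2ℚ u) (v2ℚ (disc E')) (subst (v2ℚ (disc E') ℤ.<_) v2ΔE≡ v2-drop)

Halvable : Model → Set
Halvable E = Σ[ r ∈ ℚ ] Σ[ s ∈ ℚ ] Σ[ t ∈ ℚ ] Σ[ E' ∈ Model ]
  IntegralModel2 E' × scale (k (+ 2)) E' ≡ shift r s t E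

halvable⇒NotMinimal2 : ∀ E → disc E ≢ 0ℚ → Halvable E → NotMinimal2 E
halvable⇒NotMinimal2 E ΔE≢0 (r , s , t , E' , E'-integral , eq) =
  E' , E'-integral , scale≡shift⇒Transforms E E' (k (+ 2)) r s t (λ ()) eq ,
  subst (v2ℚ (disc E') ℤ.<_) (sym v2ΔE≡) v2ΔE'<12+v2ΔE'
  where
  ΔE≡2¹²ΔE' : disc E ≡ k (+ 2) ^ 12 * disc E'
  ΔE≡2¹²ΔE' = disc-invariance E E' (k (+ 2)) r s t eq
  v2ΔE≡ : v2ℚ (disc E) ≡ + 12 ℤ.* + 1 ℤ.+ v2ℚ (disc E')
  v2ΔE≡ = trans (cong v2ℚ ΔE≡2¹²ΔE') (v2ℚ-u¹²* (k (+ 2)) (disc E') (subst (_≢ 0ℚ) ΔE≡2¹²ΔE' ΔE≢0))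
  v2ΔE'<12+v2ΔE' : v2ℚ (disc E') ℤ.< + 12 ℤ.+ v2ℚ (disc E')
  v2ΔE'<12+v2ΔE' = subst (ℤ._< + 12 ℤ.+ v2ℚ (disc E')) (ℤₚ.+-identityˡ (v2ℚ (disc E')))
                         (ℤₚ.+-monoˡ-< (v2ℚ (disc E')) (+<+ (s≤s z≤n)))

-- Short models

HalvingCongruences : ℚ → ℚ → Set
HalvingCongruences A₄ A₆ =
    (k (+ 16) ∣₂ A₄ × (k (+ 64) ∣₂ A₆ ⊎ k (+ 64) ∣₂ (A₆ - k (+ 16))))
  ⊎ (k (+ 8) ∣₂ (A₄ - k (+ 5)) × k (+ 8) ∣₂ (A₆ - k (+ 6)))

a₄≡16α : ∀ X σ τ Z →
  let s = k (+ 2) * σ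
      r = ⅓ * (k (+ 4) * X + s * s)
      ρ = ⅓ * (X + σ * σ)
  in k (+ 16) * Z - k (+ 3) * r * r + k (+ 2) * s * (k (+ 4) * τ) ≡ k (+ 16) * (Z - k (+ 3) * ρ * ρ + σ * τ)
a₄≡16α = solve-∀ ℚ-ring

-- 3r = 4X + s² gives r = 4ρ for even s and r = 3 + 4ρ for odd s, with ρ 2-integral as below.
short-congruences : ∀ {r t A₄ A₆} X Z W s τ →
  Integral2 X → Integral2 Z → Integral2 W → Integral2 s → Integral2 τ →
  r ≡ ⅓ * (k (+ 4) * X + s * s) → t ≡ k (+ 4) * τ → A₄ ≡ k (+ 16) * Z - k (+ 3) * r * r + k (+ 2) * s * t →
  A₆ ≡ k (+ 64) * W - r * A₄ - r * r * r + t * t → HalvingCongruences A₄ A₆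
short-congruences X Z W s τ X∈ Z∈ W∈ s∈ τ∈ refl refl refl refl with parity s s∈ | parity τ τ∈
... | inj₁ (σ , refl) | inj₁ (τ′ , refl) =
  inj₁ ((α , a₄≡16α X (val σ) (k (+ 2) * val τ′) Z) ,
        inj₁ (W₂ -₂ ρ *₂ α -₂ ρ *₂ ρ *₂ ρ +₂ τ′ *₂ τ′ , a₆≡64[…] X (val σ) (val τ′) Z W))
  where
  ρ = ⅓₂ *₂ (⟨ X , X∈ ⟩ +₂ σ *₂ σ)
  α = ⟨ Z , Z∈ ⟩ -₂ ι (+ 3) *₂ ρ *₂ ρ +₂ σ *₂ ⟨ k (+ 2) * val τ′ , τ∈ ⟩
  W₂ = ⟨ W , W∈ ⟩
  a₆≡64[…] : ∀ X σ τ′ Z W →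
    let s  = k (+ 2) * σ
        t  = k (+ 4) * (k (+ 2) * τ′)
        r  = ⅓ * (k (+ 4) * X + s * s)
        A₄ = k (+ 16) * Z - k (+ 3) * r * r + k (+ 2) * s * t
        ρ  = ⅓ * (X + σ * σ)
        α  = Z - k (+ 3) * ρ * ρ + σ * (k (+ 2) * τ′)
    in k (+ 64) * W - r * A₄ - r * r * r + t * t ≡ k (+ 64) * (W - ρ * α - ρ * ρ * ρ + τ′ * τ′)
  a₆≡64[…] = solve-∀ ℚ-ring
... | inj₁ (σ , refl) | inj₂ (τ′ , refl) =
  inj₁ ((α , a₄≡16α X (val σ) (1ℚ + k (+ 2) * val τ′) Z) ,
        inj₂ (W₂ -₂ ρ *₂ α -₂ ρ *₂ ρ *₂ ρ +₂ τ′ +₂ τ′ *₂ τ′ , a₆-16≡64[…] X (val σ) (val τ′) Z W))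
  where
  ρ = ⅓₂ *₂ (⟨ X , X∈ ⟩ +₂ σ *₂ σ)
  α = ⟨ Z , Z∈ ⟩ -₂ ι (+ 3) *₂ ρ *₂ ρ +₂ σ *₂ ⟨ 1ℚ + k (+ 2) * val τ′ , τ∈ ⟩
  W₂ = ⟨ W , W∈ ⟩
  a₆-16≡64[…] : ∀ X σ τ′ Z W →
    let s  = k (+ 2) * σ
        t  = k (+ 4) * (1ℚ + k (+ 2) * τ′)
        r  = ⅓ * (k (+ 4) * X + s * s)
        A₄ = k (+ 16) * Z - k (+ 3) * r * r + k (+ 2) * s * t
        ρ  = ⅓ * (X + σ * σ)
        α  = Z - k (+ 3) * ρ * ρ + σ * (1ℚ + k (+ 2) * τ′)
    in k (+ 64) * W - r * A₄ - r * r * r + t * t - k (+ 16) ≡ k (+ 64) * (W - ρ * α - ρ * ρ * ρ + τ′ + τ′ * τ′)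
  a₆-16≡64[…] = solve-∀ ℚ-ring
... | inj₂ (σ , refl) | _ =
  inj₂ ((β , a₄-5≡8β X (val σ) τ Z) , (γ , a₆-6≡8γ X (val σ) τ Z W))
  where
  τ₂ = ⟨ τ , τ∈ ⟩
  ρ = ⅓₂ *₂ (⟨ X , X∈ ⟩ +₂ σ +₂ σ *₂ σ -₂ ι (+ 2))
  β = ι (+ 2) *₂ ⟨ Z , Z∈ ⟩ -₂ ι (+ 4) -₂ ι (+ 9) *₂ ρ -₂ ι (+ 6) *₂ ρ *₂ ρ +₂ τ₂ +₂ ι (+ 2) *₂ σ *₂ τ₂
  γ = ι (+ 8) *₂ ⟨ W , W∈ ⟩ -₂ ι (+ 6) -₂ ι (+ 3) *₂ β -₂ ι (+ 16) *₂ ρ -₂ ι (+ 4) *₂ ρ *₂ β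
        -₂ ι (+ 18) *₂ ρ *₂ ρ -₂ ι (+ 8) *₂ ρ *₂ ρ *₂ ρ +₂ ι (+ 2) *₂ τ₂ *₂ τ₂
  a₄-5≡8β : ∀ X σ τ Z →
    let s = 1ℚ + k (+ 2) * σ
        r = ⅓ * (k (+ 4) * X + s * s)
        ρ = ⅓ * (X + σ + σ * σ - k (+ 2))
    in k (+ 16) * Z - k (+ 3) * r * r + k (+ 2) * s * (k (+ 4) * τ) - k (+ 5)
         ≡ k (+ 8) * (k (+ 2) * Z - k (+ 4) - k (+ 9) * ρ - k (+ 6) * ρ * ρ + τ + k (+ 2) * σ * τ)
  a₄-5≡8β = solve-∀ ℚ-ring
  a₆-6≡8γ : ∀ X σ τ Z W →
    let s  = 1ℚ + k (+ 2) * σ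
        t  = k (+ 4) * τ
        r  = ⅓ * (k (+ 4) * X + s * s)
        A₄ = k (+ 16) * Z - k (+ 3) * r * r + k (+ 2) * s * t
        ρ  = ⅓ * (X + σ + σ * σ - k (+ 2))
        β  = k (+ 2) * Z - k (+ 4) - k (+ 9) * ρ - k (+ 6) * ρ * ρ + τ + k (+ 2) * σ * τ
    in k (+ 64) * W - r * A₄ - r * r * r + t * t - k (+ 6)
         ≡ k (+ 8) * (k (+ 8) * W - k (+ 6) - k (+ 3) * β - k (+ 16) * ρ - k (+ 4) * ρ * β
                      - k (+ 18) * ρ * ρ - k (+ 8) * ρ * ρ * ρ + k (+ 2) * τ * τ)
  a₆-6≡8γ = solve-∀ ℚ-ring

isolate-s : ∀ u₀ a s → let u = k (+ 2) * u₀ in u * a ≡ 0ℚ + k (+ 2) * s → s ≡ u₀ * a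
isolate-s u₀ a s e = begin
  s                       ≡⟨ solve (s ∷ []) ℚ-ring ⟩
  ½ * (0ℚ + k (+ 2) * s)  ≡⟨ cong (½ *_) e ⟨
  ½ * (k (+ 2) * u₀ * a)  ≡⟨ solve (u₀ ∷ a ∷ []) ℚ-ring ⟩
  u₀ * a                  ∎
  where open ≡-Reasoning

isolate-r : ∀ u₀ a r s → let u = k (+ 2) * u₀ in u * u * a ≡ 0ℚ - s * 0ℚ + k (+ 3) * r - s * s →
            r ≡ ⅓ * (k (+ 4) * (u₀ * u₀ * a) + s * s)
isolate-r u₀ a r s e =
  let u = k (+ 2) * u₀ in begin
  r                                                  ≡⟨ solve (r ∷ s ∷ []) ℚ-ring ⟩
  ⅓ * ((0ℚ - s * 0ℚ + k (+ 3) * r - s * s) + s * s)  ≡⟨ cong (λ x → ⅓ * (x + s * s)) e ⟨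
  ⅓ * (u * u * a + s * s)                            ≡⟨ solve (u₀ ∷ a ∷ s ∷ []) ℚ-ring ⟩
  ⅓ * (k (+ 4) * (u₀ * u₀ * a) + s * s)              ∎
  where open ≡-Reasoning

isolate-t : ∀ u₀ a r t → let u = k (+ 2) * u₀ in u * u * u * a ≡ 0ℚ + r * 0ℚ + k (+ 2) * t →
            t ≡ k (+ 4) * (u₀ * u₀ * u₀ * a)
isolate-t u₀ a r t e =
  let u = k (+ 2) * u₀ in begin
  t                                ≡⟨ solve (r ∷ t ∷ []) ℚ-ring ⟩
  ½ * (0ℚ + r * 0ℚ + k (+ 2) * t)  ≡⟨ cong (½ *_) e ⟨
  ½ * (u * u * u * a)              ≡⟨ solve (u₀ ∷ a ∷ []) ℚ-ring ⟩
  k (+ 4) * (u₀ * u₀ * u₀ * a)     ∎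
  where open ≡-Reasoning

isolate-A₄ : ∀ u₀ a A₄ r s t → let u = k (+ 2) * u₀ in
  u * u * u * u * a ≡ A₄ - s * 0ℚ + k (+ 2) * r * 0ℚ - (t + r * s) * 0ℚ + k (+ 3) * r * r - k (+ 2) * s * t →
  A₄ ≡ k (+ 16) * (u₀ * u₀ * u₀ * u₀ * a) - k (+ 3) * r * r + k (+ 2) * s * t
isolate-A₄ u₀ a A₄ r s t e =
  let u  = k (+ 2) * u₀
      c  = - (k (+ 3) * r * r) + k (+ 2) * s * t
  in begin
  A₄
    ≡⟨ solve (A₄ ∷ r ∷ s ∷ t ∷ []) ℚ-ring ⟩
  (A₄ - s * 0ℚ + k (+ 2) * r * 0ℚ - (t + r * s) * 0ℚ + k (+ 3) * r * r - k (+ 2) * s * t) + c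
    ≡⟨ cong (_+ c) e ⟨
  u * u * u * u * a + c
    ≡⟨ solve (u₀ ∷ a ∷ r ∷ s ∷ t ∷ []) ℚ-ring ⟩
  k (+ 16) * (u₀ * u₀ * u₀ * u₀ * a) - k (+ 3) * r * r + k (+ 2) * s * t
    ∎
  where open ≡-Reasoning

isolate-A₆ : ∀ u₀ a A₄ A₆ r t → let u = k (+ 2) * u₀ in
  u * u * u * u * u * u * a ≡ A₆ + r * A₄ + r * r * 0ℚ + r * r * r - t * 0ℚ - t * t - r * t * 0ℚ →
  A₆ ≡ k (+ 64) * (u₀ * u₀ * u₀ * u₀ * u₀ * u₀ * a) - r * A₄ - r * r * r + t * t
isolate-A₆ u₀ a A₄ A₆ r t e =
  let u  = k (+ 2) * u₀
      c  = - (r * A₄) - r * r * r + t * t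
  in begin
  A₆
    ≡⟨ solve (A₄ ∷ A₆ ∷ r ∷ t ∷ []) ℚ-ring ⟩
  (A₆ + r * A₄ + r * r * 0ℚ + r * r * r - t * 0ℚ - t * t - r * t * 0ℚ) + c
    ≡⟨ cong (_+ c) e ⟨
  u * u * u * u * u * u * a + c
    ≡⟨ solve (u₀ ∷ a ∷ A₄ ∷ r ∷ t ∷ []) ℚ-ring ⟩
  k (+ 64) * (u₀ * u₀ * u₀ * u₀ * u₀ * u₀ * a) - r * A₄ - r * r * r + t * t
    ∎
  where open ≡-Reasoning

halving⇒congruences : ∀ A₄ A₆ E' u₀ r s t → Integral2 u₀ → IntegralModel2 E' →
  scale (k (+ 2) * u₀) E' ≡ shift r s t (model 0ℚ 0ℚ 0ℚ A₄ A₆) → HalvingCongruences A₄ A₆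
halving⇒congruences A₄ A₆ E' u₀ r s t u₀∈ (i₁ , i₂ , i₃ , i₄ , i₆) eq =
  short-congruences (u₀ * u₀ * a2 E') (u₀ * u₀ * u₀ * u₀ * a4 E') (u₀ * u₀ * u₀ * u₀ * u₀ * u₀ * a6 E') s
    (u₀ * u₀ * u₀ * a3 E')
    (integral (U *₂ U *₂ ⟨ a2 E' , i₂ ⟩)) (integral (U *₂ U *₂ U *₂ U *₂ ⟨ a4 E' , i₄ ⟩))
    (integral (U *₂ U *₂ U *₂ U *₂ U *₂ U *₂ ⟨ a6 E' , i₆ ⟩))
    (subst Integral2 (sym (isolate-s u₀ (a1 E') s (cong a1 eq))) (integral (U *₂ ⟨ a1 E' , i₁ ⟩)))
    (integral (U *₂ U *₂ U *₂ ⟨ a3 E' , i₃ ⟩))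
    (isolate-r u₀ (a2 E') r s (cong a2 eq)) (isolate-t u₀ (a3 E') r t (cong a3 eq))
    (isolate-A₄ u₀ (a4 E') A₄ r s t (cong a4 eq)) (isolate-A₆ u₀ (a6 E') A₄ A₆ r t (cong a6 eq))
  where
  U = ⟨ u₀ , u₀∈ ⟩


halvable-case₁ : ∀ a b → Integral2 a → Integral2 b → Halvable (model 0ℚ 0ℚ 0ℚ (k (+ 16) * a) (k (+ 64) * b))
halvable-case₁ a b a∈ b∈ =
  0ℚ , 0ℚ , 0ℚ , model 0ℚ 0ℚ 0ℚ a b , (refl , refl , refl , a∈ , b∈) ,
  model-≡ refl refl refl (solve (a ∷ []) ℚ-ring) (solve (a ∷ b ∷ []) ℚ-ring)

halvable-case₂ : ∀ a b → Integral2 a → Integral2 b →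
                 Halvable (model 0ℚ 0ℚ 0ℚ (k (+ 16) * a) (k (+ 16) + k (+ 64) * b))
halvable-case₂ a b a∈ b∈ =
  0ℚ , 0ℚ , k (+ 4) , model 0ℚ 0ℚ 1ℚ a b , (refl , refl , refl , a∈ , b∈) ,
  model-≡ refl refl refl (solve (a ∷ []) ℚ-ring) (solve (a ∷ b ∷ []) ℚ-ring)

-- Q = (2¹²W − Δ)/2⁹ vanishes by hypothesis. Modulo 2 it says a ≡ b, made explicit as b = 2g − a
-- (using Q = 0); after substituting b = 2g − a, 2⁶Y is the a₆-equation minus 8Q.
halvable-case₃ : ∀ a b W → Integral2 a → Integral2 b → Integral2 W →
  disc (model 0ℚ 0ℚ 0ℚ (k (+ 5) + k (+ 8) * a) (k (+ 6) + k (+ 8) * b)) ≡ k (+ 4096) * W →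
  Halvable (model 0ℚ 0ℚ 0ℚ (k (+ 5) + k (+ 8) * a) (k (+ 6) + k (+ 8) * b))
halvable-case₃ a b W a∈ b∈ W∈ Δ≡4096W =
  k (+ 3) , 1ℚ , k (+ 16) + k (+ 4) * a , model 1ℚ (k (+ 2)) (k (+ 4) + a) 0ℚ (val Y) ,
  (refl , refl , integral (ι (+ 4) +₂ A) , refl , integral Y) ,
  model-≡ refl refl (solve (a ∷ []) ℚ-ring) (solve (a ∷ []) ℚ-ring) a₆-equation
  where
  open ≡-Reasoning
  A = ⟨ a , a∈ ⟩
  B = ⟨ b , b∈ ⟩
  g = -₂ (ι (+ 4) *₂ ⟨ W , W∈ ⟩) -₂ ι (+ 23) -₂ ι (+ 37) *₂ A -₂ ι (+ 60) *₂ A *₂ A -₂ ι (+ 32) *₂ A *₂ A *₂ A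
        -₂ ι (+ 40) *₂ B -₂ ι (+ 27) *₂ B *₂ B
  Y = -₂ ⟨ W , W∈ ⟩ -₂ ι (+ 9) -₂ A -₂ ι (+ 22) *₂ A *₂ A -₂ ι (+ 8) *₂ A *₂ A *₂ A -₂ ι (+ 20) *₂ g
        -₂ ι (+ 27) *₂ g *₂ g +₂ ι (+ 27) *₂ A *₂ g
  Q≡0 : k (+ 46) + k (+ 75) * a + k (+ 120) * a * a + k (+ 64) * a * a * a + k (+ 81) * b + k (+ 54) * b * b
          + k (+ 8) * W ≡ 0ℚ
  Q≡0 =
    let A₄ = k (+ 5) + k (+ 8) * a
        A₆ = k (+ 6) + k (+ 8) * b
        c  = - (+ 1 ℚ./ 512)
    in begin
    k (+ 46) + k (+ 75) * a + k (+ 120) * a * a + k (+ 64) * a * a * a + k (+ 81) * b + k (+ 54) * b * b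
      + k (+ 8) * W
      ≡⟨ solve (a ∷ b ∷ W ∷ []) ℚ-ring ⟩
    c * (- (k (+ 16) * (k (+ 4) * A₄ * A₄ * A₄ + k (+ 27) * A₆ * A₆)) - k (+ 4096) * W)
      ≡⟨ cong (λ x → c * (x - k (+ 4096) * W)) (trans (sym (disc-of-short A₄ A₆)) Δ≡4096W) ⟩
    c * (k (+ 4096) * W - k (+ 4096) * W)
      ≡⟨ solve (W ∷ []) ℚ-ring ⟩
    0ℚ ∎
  b≡2g-a : b ≡ k (+ 2) * val g - a
  b≡2g-a =
    let g′ = - (k (+ 4) * W) - k (+ 23) - k (+ 37) * a - k (+ 60) * a * a - k (+ 32) * a * a * a
               - k (+ 40) * b - k (+ 27) * b * b
        Q  = k (+ 46) + k (+ 75) * a + k (+ 120) * a * a + k (+ 64) * a * a * a + k (+ 81) * b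
               + k (+ 54) * b * b + k (+ 8) * W
    in begin
    b                      ≡⟨ solve (a ∷ b ∷ W ∷ []) ℚ-ring ⟩
    k (+ 2) * g′ - a + Q   ≡⟨ cong (λ q → k (+ 2) * g′ - a + q) Q≡0 ⟩
    k (+ 2) * g′ - a + 0ℚ  ≡⟨ solve (a ∷ b ∷ W ∷ []) ℚ-ring ⟩
    k (+ 2) * g′ - a       ∎
  identity : ∀ a g W →
    let b = k (+ 2) * g - a
        t = k (+ 16) + k (+ 4) * a
        Q = k (+ 46) + k (+ 75) * a + k (+ 120) * a * a + k (+ 64) * a * a * a + k (+ 81) * b
              + k (+ 54) * b * b + k (+ 8) * W
    in k (+ 2) * k (+ 2) * k (+ 2) * k (+ 2) * k (+ 2) * k (+ 2)
         * (- W - k (+ 9) - a - k (+ 22) * a * a - k (+ 8) * a * a * a - k (+ 20) * g - k (+ 27) * g * g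
            + k (+ 27) * a * g)
       ≡ (k (+ 6) + k (+ 8) * b) + k (+ 3) * (k (+ 5) + k (+ 8) * a) + k (+ 3) * k (+ 3) * 0ℚ
           + k (+ 3) * k (+ 3) * k (+ 3) - t * 0ℚ - t * t - k (+ 3) * t * 0ℚ - k (+ 8) * Q
  identity = solve-∀ ℚ-ring
  a₆-equation :
    let t = k (+ 16) + k (+ 4) * a in
    k (+ 2) * k (+ 2) * k (+ 2) * k (+ 2) * k (+ 2) * k (+ 2) * val Y
      ≡ (k (+ 6) + k (+ 8) * b) + k (+ 3) * (k (+ 5) + k (+ 8) * a) + k (+ 3) * k (+ 3) * 0ℚ
          + k (+ 3) * k (+ 3) * k (+ 3) - t * 0ℚ - t * t - k (+ 3) * t * 0ℚ
  a₆-equation =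
    let t = k (+ 16) + k (+ 4) * a
        rhs : ℚ → ℚ
        rhs b = (k (+ 6) + k (+ 8) * b) + k (+ 3) * (k (+ 5) + k (+ 8) * a) + k (+ 3) * k (+ 3) * 0ℚ
                  + k (+ 3) * k (+ 3) * k (+ 3) - t * 0ℚ - t * t - k (+ 3) * t * 0ℚ
        Q : ℚ → ℚ
        Q b = k (+ 46) + k (+ 75) * a + k (+ 120) * a * a + k (+ 64) * a * a * a + k (+ 81) * b
                + k (+ 54) * b * b + k (+ 8) * W
    in begin
    k (+ 2) * k (+ 2) * k (+ 2) * k (+ 2) * k (+ 2) * k (+ 2) * val Y
      ≡⟨ identity a (val g) W ⟩
    rhs (k (+ 2) * val g - a) - k (+ 8) * Q (k (+ 2) * val g - a)
      ≡⟨ cong (λ b′ → rhs b′ - k (+ 8) * Q b′) b≡2g-a ⟨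
    rhs b - k (+ 8) * Q b                  ≡⟨ cong (λ q → rhs b - k (+ 8) * q) Q≡0 ⟩
    rhs b - k (+ 8) * 0ℚ                   ≡⟨ solve (a ∷ b ∷ []) ℚ-ring ⟩
    rhs b                                  ∎


Criterion : ℤ → ℤ → Set
Criterion a₄ a₆ =
    (v2≥ a₄ 4 × v2≥ a₆ 6)
  ⊎ (v2≥ a₄ 4 × (+ 64 ∣ (a₆ ℤ.- + 16)))
  ⊎ ((+ 8 ∣ (a₄ ℤ.- + 5)) × (+ 8 ∣ (a₆ ℤ.- + 6)) × v2≥ (Δshort a₄ a₆) 12)

disc-short≢0 : ∀ a₄ a₆ → Δshort a₄ a₆ ≢ + 0 → disc (short a₄ a₆) ≢ 0ℚ
disc-short≢0 a₄ a₆ Δ≢0 Δ≡0 = Δ≢0 (ℚof-injective (trans (sym (disc-short a₄ a₆)) Δ≡0))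

not-minimal⇒criterion : ∀ a₄ a₆ → Δshort a₄ a₆ ≢ + 0 → NotMinimal2 (short a₄ a₆) → Criterion a₄ a₆
not-minimal⇒criterion a₄ a₆ Δ≢0 (E' , E'-integral , (u , r , s , t , _ , e₁ , e₂ , e₃ , e₄ , e₆) , v2-drop) =
  to-ℤ (halving⇒congruences (ℚof a₄) (ℚof a₆) E' (val u₀) r s t (integral u₀) E'-integral
         (subst (λ u → scale u E' ≡ shift r s t (short a₄ a₆)) u≡2u₀ eq))
  where
  eq : scale u E' ≡ shift r s t (short a₄ a₆)
  eq = model-≡ e₁ e₂ e₃ e₄ e₆
  bounds : + 1 ℤ.≤ v2ℚ u × + 12 ℤ.≤ v2ℚ (disc (short a₄ a₆))
  bounds = v2-drop⇒1≤v2u×12≤v2Δ (short a₄ a₆) E' u r s t E'-integral (disc-short≢0 a₄ a₆ Δ≢0) eq v2-drop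
  u₀ : ℤ₍₂₎
  u₀ = proj₁ (1≤v2ℚ⇒2∣₂ u (proj₁ bounds))
  u≡2u₀ : u ≡ k (+ 2) * val u₀
  u≡2u₀ = proj₂ (1≤v2ℚ⇒2∣₂ u (proj₁ bounds))
  2¹²∣Δ : v2≥ (Δshort a₄ a₆) 12
  2¹²∣Δ = 2^∣-of-≤v2ℕ (λ ∣Δ∣≡0 → Δ≢0 (ℤₚ.∣i∣≡0⇒i≡0 ∣Δ∣≡0)) (ℤₚ.drop‿+≤+
            (subst (+ 12 ℤ.≤_) (trans (cong v2ℚ (disc-short a₄ a₆)) (v2ℚ-ℚof (Δshort a₄ a₆))) (proj₂ bounds)))
  shifted : ∀ {c} x n → k (+ n) ∣₂ (ℚof x - ℚof c) → k (+ n) ∣₂ ℚof (x ℤ.- c)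
  shifted {c} x n = subst (k (+ n) ∣₂_) (sym (ℚof-- x c))
  to-ℤ : HalvingCongruences (ℚof a₄) (ℚof a₆) → Criterion a₄ a₆
  to-ℤ (inj₁ (16∣a₄ , inj₁ 64∣a₆)) =
    inj₁ (2^j∣₂ℚof⇒2^j∣ 4 a₄ 16∣a₄ , 2^j∣₂ℚof⇒2^j∣ 6 a₆ 64∣a₆)
  to-ℤ (inj₁ (16∣a₄ , inj₂ 64∣a₆-16)) =
    inj₂ (inj₁ (2^j∣₂ℚof⇒2^j∣ 4 a₄ 16∣a₄ , 2^j∣₂ℚof⇒2^j∣ 6 (a₆ ℤ.- + 16) (shifted a₆ 64 64∣a₆-16)))
  to-ℤ (inj₂ (8∣a₄-5 , 8∣a₆-6)) =
    inj₂ (inj₂ (2^j∣₂ℚof⇒2^j∣ 3 (a₄ ℤ.- + 5) (shifted a₄ 8 8∣a₄-5) ,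
                2^j∣₂ℚof⇒2^j∣ 3 (a₆ ℤ.- + 6) (shifted a₆ 8 8∣a₆-6) , 2¹²∣Δ))

criterion⇒not-minimal : ∀ a₄ a₆ → Δshort a₄ a₆ ≢ + 0 → Criterion a₄ a₆ → NotMinimal2 (short a₄ a₆)
criterion⇒not-minimal a₄ a₆ Δ≢0 criterion =
  halvable⇒NotMinimal2 (short a₄ a₆) (disc-short≢0 a₄ a₆ Δ≢0) (halvable criterion)
  where
  short-halvable : ∀ {A₄ A₆} → ℚof a₄ ≡ A₄ → ℚof a₆ ≡ A₆ →
                   Halvable (model 0ℚ 0ℚ 0ℚ A₄ A₆) → Halvable (short a₄ a₆)
  short-halvable refl refl h = h
  halvable : Criterion a₄ a₆ → Halvable (short a₄ a₆)
  halvable (inj₁ (16∣a₄ , 64∣a₆)) =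
    let q₄ , a₄≡ = ∣⇒ℚof≡ 16 a₄ 16∣a₄
        q₆ , a₆≡ = ∣⇒ℚof≡ 64 a₆ 64∣a₆
    in short-halvable a₄≡ a₆≡ (halvable-case₁ (ℚof q₄) (ℚof q₆) (Integral2-ℚof q₄) (Integral2-ℚof q₆))
  halvable (inj₂ (inj₁ (16∣a₄ , 64∣a₆-16))) =
    let q₄ , a₄≡ = ∣⇒ℚof≡ 16 a₄ 16∣a₄
        q₆ , a₆≡ = ∣-⇒ℚof≡ 64 a₆ (+ 16) 64∣a₆-16
    in short-halvable a₄≡ a₆≡ (halvable-case₂ (ℚof q₄) (ℚof q₆) (Integral2-ℚof q₄) (Integral2-ℚof q₆))
  halvable (inj₂ (inj₂ (8∣a₄-5 , 8∣a₆-6 , 2¹²∣Δ))) =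
    let α , a₄≡ = ∣-⇒ℚof≡ 8 a₄ (+ 5) 8∣a₄-5
        β , a₆≡ = ∣-⇒ℚof≡ 8 a₆ (+ 6) 8∣a₆-6
        w , Δ≡  = ∣⇒ℚof≡ 4096 (Δshort a₄ a₆) 2¹²∣Δ
    in short-halvable a₄≡ a₆≡ (halvable-case₃ (ℚof α) (ℚof β) (ℚof w)
         (Integral2-ℚof α) (Integral2-ℚof β) (Integral2-ℚof w)
         (subst₂ (λ A₄ A₆ → disc (model 0ℚ 0ℚ 0ℚ A₄ A₆) ≡ k (+ 4096) * ℚof w) a₄≡ a₆≡
                 (trans (disc-short a₄ a₆) Δ≡)))

lemma2p3 : (a4 a6 : ℤ) → Δshort a4 a6 ≢ + 0 →
    NotMinimal2 (short a4 a6) ⇔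
      ( (v2≥ a4 4 × v2≥ a6 6)
      ⊎ (v2≥ a4 4 × (+ 64 ∣ (a6 ℤ.- + 16)))
      ⊎ ((+ 8 ∣ (a4 ℤ.- + 5)) × (+ 8 ∣ (a6 ℤ.- + 6)) × v2≥ (Δshort a4 a6) 12) )
lemma2p3 a4 a6 Δ≢0 = mk⇔ (not-minimal⇒criterion a4 a6 Δ≢0) (criterion⇒not-minimal a4 a6 Δ≢0)
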